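{- Let $\psi\in\mathscr G$ and let $m,n$ be positive integers such that the restrictions of $\psi$ to $\mathscr A_m$ and to $\mathscr A_n$ are not identically zero. Then $\kappa(m;\psi)\equiv\kappa(n;\psi)\pmod{\gcd(m,n)}$.
   Context: $\mathscr A$ is the commutative algebra of all complex-valued periodic functions on $\mathbb Z$ with pointwise operations, $\mathscr A_p$ the subalgebra of $p$-periodic functions, and $\mathscr G$ the set of nonzero linear multiplicative functionals $\mathscr A\to\mathbb C$. If $\psi|_{\mathscr A_p}$ is not identically zero, then there is a unique integer $k$ with $0\le k<p$ such that $\psi(u)=u(k)$ for all $u\in\mathscr A_p$; this $k$ is denoted $\kappa(p;\psi)$. -}

module Defs where

open import Level using (Level; suc; _⊔_)
open import Algebra.Bundles using (CommutativeRing)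
open import Data.Nat as ℕ using (ℕ; NonZero; _<_)
open import Data.Integer as ℤ using (ℤ; +_)
open import Data.Product using (Σ; ∃; _×_)
open import Relation.Nullary using (¬_)

-- A field: a commutative ring with 1 ≠ 0 in which every nonzero element
-- has a multiplicative inverse.  (agda-stdlib has no Field bundle and no ℂ;
-- ℂ is the intended instance.)
record Field (c ℓ : Level) : Set (suc (c ⊔ ℓ)) where
  field
    commutativeRing : CommutativeRing c ℓ
  open CommutativeRing commutativeRing public
  field
    1≉0     : ¬ (1# ≈ 0#)
    inverse : ∀ x → ¬ (x ≈ 0#) → ∃ λ y → (x * y) ≈ 1#

module _ {c ℓ} (K : Field c ℓ) where
  open Field K

  IsPeriodicWith : ℕ → (ℤ → Carrier) → Set ℓ
  IsPeriodicWith p u = ∀ z → u (z ℤ.+ + p) ≈ u z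

  record 𝒜 : Set (c ⊔ ℓ) where
    constructor mk𝒜
    field
      fn       : ℤ → Carrier
      period   : ℕ
      .{{period-nz}} : NonZero period
      periodic : IsPeriodicWith period fn
  open 𝒜 public

  _∈𝒜[_] : 𝒜 → ℕ → Set ℓ
  u ∈𝒜[ p ] = IsPeriodicWith p (fn u)

  -- The algebra operations of 𝒜 are pointwise; ψ is required to respect them:
  -- whenever w is pointwise equal to u + v, c·u, u·v (resp. u), the values agree.
  record Is𝒢 (ψ : 𝒜 → Carrier) : Set (c ⊔ ℓ) where
    field
      well-defined : ∀ u v → (∀ z → fn u z ≈ fn v z) → ψ u ≈ ψ v
      additive     : ∀ u v w → (∀ z → fn w z ≈ fn u z + fn v z) → ψ w ≈ ψ u + ψ v
      homogeneous  : ∀ a u w → (∀ z → fn w z ≈ a * fn u z) → ψ w ≈ a * ψ u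
      multiplicative : ∀ u v w → (∀ z → fn w z ≈ fn u z * fn v z) → ψ w ≈ ψ u * ψ v
      nonzero      : ∃ λ u → ¬ (ψ u ≈ 0#)

  NonzeroOn : (𝒜 → Carrier) → ℕ → Set (c ⊔ ℓ)
  NonzeroOn ψ p = ∃ λ u → u ∈𝒜[ p ] × ¬ (ψ u ≈ 0#)

  -- k = κ(p; ψ): 0 ≤ k < p and ψ(u) = u(k) for all u ∈ 𝒜_p
  -- (such k exists and is unique when NonzeroOn ψ p; κ is its unique value)
  IsKappa : ℕ → (𝒜 → Carrier) → ℕ → Set (c ⊔ ℓ)
  IsKappa p ψ k = k < p × (∀ u → u ∈𝒜[ p ] → ψ u ≈ fn u (+ k))

module Submission where

-- Let d = gcd(m, n).  The indicator function χ of the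
-- residue class l + dℤ is d-periodic, hence both m-periodic and n-periodic.
-- Since ψ evaluates m-periodic functions at κ(m;ψ) = k and n-periodic
-- functions at κ(n;ψ) = l, we get χ(k) = ψ(χ) = χ(l) = 1, so k lies in the
-- residue class of l, i.e. d ∣ k - l.  (Otherwise χ(k) = 0 and 1 = 0 in the
-- field.)

open import Defs
open import Level using (Level)
open import Data.Nat using (ℕ; NonZero)
open import Data.Nat.Divisibility as ℕ using ()
open import Data.Nat.GCD using (gcd; gcd[m,n]∣m; gcd[m,n]∣n)
open import Data.Integer using (ℤ; +_; +0; _+_; -_; _-_)
open import Data.Integer.Divisibility using (_∣_)
open import Data.Integer.Divisibility.Signed as Signed
  using (divides; _∣?_; ∣ᵤ⇒∣; ∣⇒∣ᵤ; ∣m∣n⇒∣m+n; ∣m+n∣n⇒∣m)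
open import Data.Integer.Properties using (+-assoc; +-comm; +-inverseʳ)
open import Data.Product using (_,_)
open import Data.Empty using (⊥-elim)
open import Function using (_⇔_; mk⇔; Equivalence)
open import Relation.Nullary using (Dec; yes; no; ¬_)
open import Relation.Binary.PropositionalEquality
  using (_≡_; cong; sym; subst; module ≡-Reasoning)

shift-difference : ∀ z p a → (z + p) - a ≡ (z - a) + p
shift-difference z p a = begin
  (z + p) + - a   ≡⟨ +-assoc z p (- a) ⟩
  z + (p + - a)   ≡⟨ cong (λ w → z + w) (+-comm p (- a)) ⟩
  z + (- a + p)   ≡⟨ sym (+-assoc z (- a) p) ⟩
  (z + - a) + p   ∎
  where open ≡-Reasoning

congruence-shift : ∀ {d p} a z → d Signed.∣ p →
                   (d Signed.∣ (z + p) - a) ⇔ (d Signed.∣ z - a)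
congruence-shift {d} {p} a z d∣p = mk⇔
  (λ d∣z+p-a → ∣m+n∣n⇒∣m (subst (d Signed.∣_) (shift-difference z p a) d∣z+p-a) d∣p)
  (λ d∣z-a → subst (d Signed.∣_) (sym (shift-difference z p a)) (∣m∣n⇒∣m+n d∣z-a d∣p))

module _ {c ℓ : Level} (K : Field c ℓ) where
  open Field K using (Carrier; _≈_; 0#; 1#; 1≉0)
    renaming (refl to ≈-refl; sym to ≈-sym; trans to ≈-trans)

  indicator : {P : Set} → Dec P → Carrier
  indicator (yes _) = 1#
  indicator (no _)  = 0#

  indicator-yes : {P : Set} (P? : Dec P) → P → indicator P? ≈ 1#
  indicator-yes (yes _) _  = ≈-refl
  indicator-yes (no ¬p) p  = ⊥-elim (¬p p)

  indicator-no : {P : Set} (P? : Dec P) → ¬ P → indicator P? ≈ 0#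
  indicator-no (yes p) ¬p = ⊥-elim (¬p p)
  indicator-no (no _)  _  = ≈-refl

  indicator-cong : {P Q : Set} → P ⇔ Q → (P? : Dec P) (Q? : Dec Q) →
                   indicator P? ≈ indicator Q?
  indicator-cong P⇔Q P? (yes q) = indicator-yes P? (Equivalence.from P⇔Q q)
  indicator-cong P⇔Q P? (no ¬q) = indicator-no P? (λ p → ¬q (Equivalence.to P⇔Q p))

  residueClass : ℤ → ℤ → ℤ → Carrier
  residueClass d a z = indicator (d ∣? z - a)

  residueClass-periodic : ∀ d a p → d Signed.∣ + p →
                          IsPeriodicWith K p (residueClass d a)
  residueClass-periodic d a p d∣p z =
    indicator-cong (congruence-shift a z d∣p) (d ∣? (z + + p) - a) (d ∣? z - a)

  kappa-congruent : (ψ : 𝒜 K → Carrier) (p q d : ℕ) → .{{NonZero p}} → .{{NonZero q}} →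
                    d ℕ.∣ p → d ℕ.∣ q →
                    (k l : ℕ) → IsKappa K p ψ k → IsKappa K q ψ l →
                    + d Signed.∣ + k - + l
  kappa-congruent ψ p q d d∣p d∣q k l (_ , ψ-at-k) (_ , ψ-at-l)
    with + d ∣? + k - + l
  ... | yes d∣k-l = d∣k-l
  ... | no  d∤k-l = ⊥-elim (1≉0 (≈-trans (≈-sym ψχ≈1) ψχ≈0))
    where
    χ-periodic : ∀ r → d ℕ.∣ r → IsPeriodicWith K r (residueClass (+ d) (+ l))
    χ-periodic r d∣r = residueClass-periodic (+ d) (+ l) r (∣ᵤ⇒∣ d∣r)

    χ : 𝒜 K
    χ = mk𝒜 (residueClass (+ d) (+ l)) p (χ-periodic p d∣p)

    ψχ≈0 : ψ χ ≈ 0#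
    ψχ≈0 = ≈-trans (ψ-at-k χ (χ-periodic p d∣p)) (indicator-no (+ d ∣? + k - + l) d∤k-l)

    ψχ≈1 : ψ χ ≈ 1#
    ψχ≈1 = ≈-trans (ψ-at-l χ (χ-periodic q d∣q))
                   (indicator-yes (+ d ∣? + l - + l) (divides +0 (+-inverseʳ (+ l))))

mainTheorem4 : ∀ {c ℓ : Level} (K : Field c ℓ) (ψ : 𝒜 K → Field.Carrier K) → Is𝒢 K ψ →
    (m n : ℕ) → .{{NonZero m}} → .{{NonZero n}} →
    NonzeroOn K ψ m → NonzeroOn K ψ n →
    (k l : ℕ) → IsKappa K m ψ k → IsKappa K n ψ l →
    (+ gcd m n) ∣ (+ k - + l)
-- The multiplicativity of ψ and the nonvanishing hypotheses only serve to make
-- κ(m;ψ) and κ(n;ψ) exist; given k and l, the evaluation property suffices.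
mainTheorem4 K ψ _ m n _ _ k l κm κn =
  ∣⇒∣ᵤ (kappa-congruent K ψ m n (gcd m n) (gcd[m,n]∣m m n) (gcd[m,n]∣n m n) k l κm κn)
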